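{- Let $\xi\in\mathbb{F}_q((T^{ -1}))\setminus\mathbb{F}_q(T)$ with $|\xi|\le1$ and convergents $P_n/Q_n$, let $k\in\mathbb{N}$, $a\in\mathbb{F}_q[T]$, $N=\begin{pmatrix} t & t'\\ s & s'\end{pmatrix}\in\mathrm{SL}_2(\mathbb{F}_q[T])$, and write $\gamma = N\,U(a)\,M_k = \begin{pmatrix} V_1 & U_1\\ V_2 & U_2\end{pmatrix}$. For $y\in\mathbb{F}_q((T^{ -1}))$ put $\delta = sy - t$ and $\delta' = s'y - t'$. Then \[ |V_1\xi + U_1 - y(V_2\xi + U_2)| \leq \max\left\{ \left|\frac{\delta}{Q_{k+1}}\right|, \left|\frac{\delta a + \delta'}{Q_k}\right| \right\}. \]
   Context: $\mathbb{F}_q((T^{ -1}))$ is the field of formal Laurent series in $T^{ -1}$ over the finite field $\mathbb{F}_q$ with absolute value $|x|=q^{\deg x}$, $|0|=0$. Convergents: $\xi=[A_0;A_1,\dots]$ is the continued fraction expansion ($A_i\in\mathbb{F}_q[T]$, $\deg A_i>0$ for $i\ge1$), $P_{ -2}=0,P_{ -1}=1,Q_{ -2}=1,Q_{ -1}=0$, $P_n=A_nP_{n-1}+P_{n-2}$, $Q_n=A_nQ_{n-1}+Q_{n-2}$ ($n\ge0$). $U(a)=\begin{pmatrix}1&a\\0&1\end{pmatrix}$ and $M_k=\begin{pmatrix} Q_k & -P_k\\ (-1)^{k-1}Q_{k-1} & (-1)^kP_{k-1}\end{pmatrix}$. -}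

module Defs where

open import Level using (0ℓ)
open import Data.Nat as ℕ using (ℕ; zero; suc)
open import Data.Fin using (Fin)
open import Data.Integer as ℤ using (ℤ; +_; _<_; _≤_)
import Data.Integer.Properties as ℤP
open import Data.Product using (Σ; ∃; _×_; _,_)
open import Data.Bool using (if_then_else_)
open import Relation.Nullary using (¬_; does)
open import Relation.Binary using (Decidable)
open import Relation.Binary.PropositionalEquality as P using (_≡_)
open import Function.Bundles using (Surjection)
open import Function using (_∘_)
open import Algebra.Bundles using (CommutativeRing)
import Algebra.Bundles
import Algebra.Properties.RingWithoutOne as RP
import Relation.Binary.Reasoning.Setoid as SetoidR

record FiniteField : Set₁ where
  field
    cring    : CommutativeRing 0ℓ 0ℓ
  open CommutativeRing cring public
  field
    _≟_      : Decidable _≈_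
    0≉1      : ¬ (0# ≈ 1#)
    inverse  : ∀ x → ¬ (x ≈ 0#) → Σ Carrier λ y → (x * y) ≈ 1#
    q        : ℕ
    enum     : Fin q → Carrier
    enum-surj : ∀ x → Σ (Fin q) λ i → enum i ≈ x
    enum-inj  : ∀ i j → enum i ≈ enum j → i ≡ j

-- Formal Laurent series in T⁻¹ over F_q.
-- A series is a coefficient function ℤ → F (coef j = coefficient of T^j)
-- together with an upper bound beyond which all coefficients vanish.

module Laurent (F : FiniteField) where
  open FiniteField F

  record LS : Set where
    field
      coef   : ℤ → Carrier
      bnd    : ℤ
      vanish : ∀ j → bnd < j → coef j ≈ 0#
  open LS public

  _≈L_ : LS → LS → Set
  x ≈L y = ∀ j → coef x j ≈ coef y j

  private
    module R = RP (Algebra.Bundles.Ring.ringWithoutOne ring)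
    sum : ℕ → (ℕ → Carrier) → Carrier
    sum zero    f = 0#
    sum (suc m) f = f m + sum m f
    sum0 : ∀ m f → (∀ i → f i ≈ 0#) → sum m f ≈ 0#
    sum0 zero    f h = refl
    sum0 (suc m) f h = trans (+-cong (h m) (sum0 m f h)) (+-identityˡ 0#)

  0L : LS
  0L = record { coef = λ _ → 0# ; bnd = + 0 ; vanish = λ _ _ → refl }

  1L : LS
  1L = record { coef = c ; bnd = + 0 ; vanish = v }
    where
    c : ℤ → Carrier
    c j = if does (j ℤ.≟ + 0) then 1# else 0#
    v : ∀ j → + 0 < j → c j ≈ 0#
    v j 0<j with j ℤ.≟ + 0
    ... | Relation.Nullary.yes P.refl = Data.Empty.⊥-elim (ℤP.<-irrefl P.refl 0<j)
      where import Data.Empty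
    ... | Relation.Nullary.no _ = refl

  infixl 6 _+L_ _-L_
  infixl 7 _*L_

  _+L_ : LS → LS → LS
  x +L y = record
    { coef = λ j → coef x j + coef y j
    ; bnd = bnd x ℤ.⊔ bnd y
    ; vanish = λ j lt → trans (+-cong (vanish x j (ℤP.≤-<-trans (ℤP.i≤i⊔j (bnd x) (bnd y)) lt))
                                      (vanish y j (ℤP.≤-<-trans (ℤP.i≤j⊔i (bnd x) (bnd y)) lt)))
                              (+-identityˡ 0#) }

  -L_ : LS → LS
  -L x = record
    { coef = λ j → - coef x j
    ; bnd = bnd x
    ; vanish = λ j lt → trans (-‿cong (vanish x j lt)) R.-0#≈0# }

  _-L_ : LS → LS → LS
  x -L y = x +L (-L y)

  -- Cauchy product: coefficient of T^n is Σ_{i} x_{bx-i} y_{n-bx+i},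
  -- i ranging over 0 … |bx+by-n| (all other terms vanish).
  _*L_ : LS → LS → LS
  x *L y = record
    { coef = c
    ; bnd = bnd x ℤ.+ bnd y
    ; vanish = v }
    where
    bx = bnd x
    by = bnd y
    term : ℤ → ℕ → Carrier
    term n i = coef x (bx ℤ.- + i) * coef y (n ℤ.- bx ℤ.+ + i)
    c : ℤ → Carrier
    c n = sum (suc ℤ.∣ bx ℤ.+ by ℤ.- n ∣) (term n)
    v : ∀ n → bx ℤ.+ by < n → c n ≈ 0#
    v n lt = sum0 (suc ℤ.∣ bx ℤ.+ by ℤ.- n ∣) (term n) λ i →
      trans (*-congˡ (vanish y _ (ℤP.<-≤-trans lt' (ℤP.i≤i+j (n ℤ.- bx) (+ i)))))
            (zeroʳ _)
      where
      eq : by ≡ bx ℤ.+ by ℤ.- bx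
      eq = P.sym (P.trans (P.cong (ℤ._- bx) (ℤP.+-comm bx by))
                   (P.trans (ℤP.+-assoc by bx (ℤ.- bx))
                   (P.trans (P.cong (λ z → by ℤ.+ z) (ℤP.+-inverseʳ bx)) (ℤP.+-identityʳ by))))
      lt' : by < n ℤ.- bx
      lt' = P.subst (_< n ℤ.- bx) (P.sym eq) (ℤP.+-monoˡ-< (ℤ.- bx) lt)

  -- |x| ≤ q^e  (all coefficients of T^j with j > e vanish)
  AbsLe : LS → ℤ → Set
  AbsLe x e = ∀ j → e < j → coef x j ≈ 0#

  IsPoly : LS → Set
  IsPoly x = ∀ j → j < + 0 → coef x j ≈ 0#

  IsDeg : LS → ℤ → Set
  IsDeg p d = ¬ (coef p d ≈ 0#) × AbsLe p d

  PosDeg : LS → Set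
  PosDeg p = Σ ℤ λ d → (+ 0 < d) × IsDeg p d

  -- |x / Q| ≤ q^e for a nonzero polynomial Q, i.e. |x| ≤ q^(e + deg Q)
  AbsQuotLe : LS → LS → ℤ → Set
  AbsQuotLe x Q e = ∀ d → IsDeg Q d → AbsLe x (e ℤ.+ d)

  -- |X| ≤ max { |x/Q|, |x'/Q'| }   (values lie in q^ℤ ∪ {0})
  AbsLeMaxQuot : LS → LS → LS → LS → LS → Set
  AbsLeMaxQuot X x Q x' Q' = ∀ e → AbsQuotLe x Q e → AbsQuotLe x' Q' e → AbsLe X e

  Irrational : LS → Set
  Irrational ξ = ∀ p r → IsPoly p → IsPoly r → ¬ (r ≈L 0L) → ¬ ((r *L ξ) ≈L p)

  -- Convergent numerators/denominators with shifted index: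
  -- Pm A n = P_{n-2}, Qm A n = Q_{n-2}.
  Pm Qm : (ℕ → LS) → ℕ → LS
  Pm A zero = 0L
  Pm A (suc zero) = 1L
  Pm A (suc (suc n)) = A n *L Pm A (suc n) +L Pm A n
  Qm A zero = 1L
  Qm A (suc zero) = 0L
  Qm A (suc (suc n)) = A n *L Qm A (suc n) +L Qm A n

  Pn Qn : (ℕ → LS) → ℕ → LS
  Pn A n = Pm A (suc (suc n))
  Qn A n = Qm A (suc (suc n))

  -- ξ = [A_0; A_1, A_2, …]: P_n/Q_n → ξ, i.e. for every e there is N
  -- with |ξ - P_n/Q_n| = |Q_n ξ - P_n| / |Q_n| ≤ q^(-e) for all n ≥ N.
  IsCFExpansion : LS → (ℕ → LS) → Set
  IsCFExpansion ξ A =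
    (∀ i → IsPoly (A i)) × (∀ i → PosDeg (A (suc i))) ×
    (∀ (e : ℕ) → Σ ℕ λ N → ∀ n → N ℕ.≤ n →
        AbsQuotLe (Qn A n *L ξ -L Pn A n) (Qn A n) (ℤ.- (+ e)))

  record Mat2 : Set where
    constructor mat
    field
      m11 m12 m21 m22 : LS
  open Mat2 public

  _⊗_ : Mat2 → Mat2 → Mat2
  mat a b c d ⊗ mat a' b' c' d' =
    mat (a *L a' +L b *L c') (a *L b' +L b *L d')
        (c *L a' +L d *L c') (c *L b' +L d *L d')

  InSL2 : Mat2 → Set
  InSL2 (mat t t' s s') =
    IsPoly t × IsPoly t' × IsPoly s × IsPoly s' × ((t *L s' -L t' *L s) ≈L 1L)

  U : LS → Mat2
  U a = mat 1L a 0L 1L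

  sgn : ℕ → LS
  sgn zero = 1L
  sgn (suc k) = -L sgn k

  -- M_k = [[Q_k, -P_k], [(-1)^{k-1} Q_{k-1}, (-1)^k P_{k-1}]]
  -- (note (-1)^{k-1} = (-1)^{k+1}; Q_{k-1} = Qm A (suc k))
  M : (ℕ → LS) → ℕ → Mat2
  M A k = mat (Qn A k) (-L Pn A k)
              (sgn (suc k) *L Qm A (suc k)) (sgn k *L Pm A (suc k))

-- Write r n = Q n ξ - P n. The row vector (1, -y) N U(a) is (-δ, -(δ a + δ′)) and M k maps (ξ, 1)
-- to (r k, -(-1)^k r (k-1)), so the left-hand side is -δ r k + (-1)^k (δ a + δ′) r (k-1). The claim
-- then follows from the classical bound |r n| ≤ |Q (n+1)|⁻¹, which comes from the determinant
-- identity Q n r (n+1) = Q (n+1) r n ± 1: if |r n| > |Q (n+1)|⁻¹, the product Q (n+1) r n dominates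
-- the ±1, hence |r (n+1) / Q (n+1)| = |r n / Q n|, and this ratio would stay constant forever instead
-- of tending to 0.

module Submission where

open import Defs
open import Level using (0ℓ)
open import Data.Nat as ℕ using (ℕ; zero; suc; _∸_)
import Data.Nat.Properties as ℕP
open import Data.Fin as Fin using (toℕ)
import Data.Fin.Properties as FinP
open import Data.Fin.Permutation using (reverse)
open import Data.Integer as ℤ using (ℤ; +_; -[1+_]; 1ℤ)
import Data.Integer.Properties as ℤP
open import Data.Integer.Tactic.RingSolver using (solve-∀)
open import Data.Maybe using (Maybe; just; nothing)
open import Data.Product using (∃-syntax; _,_; proj₁; proj₂)
open import Data.Sum using (_⊎_; inj₁; inj₂)
open import Relation.Nullary using (¬_; yes; no; contradiction)
open import Relation.Binary.PropositionalEquality as P using (_≡_)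
open import Relation.Binary.Structures using (IsEquivalence)
open import Relation.Binary.Bundles using (Setoid)
open import Algebra.Bundles using (CommutativeRing)
open import Algebra.Structures using (IsCommutativeRing)
open import Algebra.Solver.Ring.AlmostCommutativeRing
  using (_-Raw-AlmostCommutative⟶_; fromCommutativeRing)
import Algebra.Solver.Ring

-- Integer coefficients for the ring solver

module IntegerEmbedding {c ℓ} (R : CommutativeRing c ℓ) where
  open CommutativeRing R
  open import Algebra.Properties.Semiring.Mult.TCOptimised semiring
    using (_×_; 1+×; ×-homo-+; ×1-homo-*)
  open import Algebra.Properties.Ring ring
    using (-0#≈0#; -‿involutive; -‿+-comm; -‿distribˡ-*; -‿distribʳ-*)
  open import Algebra.Properties.CommutativeSemigroup +-commutativeSemigroup
    using (interchange)
  open import Relation.Binary.Reasoning.Setoid setoid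

  -- The type-checking-optimised n × 1# makes ι 0 and ι 1 definitionally 0# and 1#, so the
  -- solver's constants 0 and 1 match 0L and 1L.
  ι : ℤ → Carrier
  ι (+ n)    = n × 1#
  ι -[1+ n ] = - (suc n × 1#)

  private
    1+x-[1+y]≈x-y : ∀ x y → (1# + x) - (1# + y) ≈ x - y
    1+x-[1+y]≈x-y x y = begin
      (1# + x) + - (1# + y)   ≈⟨ +-congˡ (-‿+-comm 1# y) ⟨
      (1# + x) + (- 1# + - y) ≈⟨ interchange 1# x (- 1#) (- y) ⟩
      (1# - 1#) + (x - y)     ≈⟨ +-congʳ (-‿inverseʳ 1#) ⟩
      0# + (x - y)            ≈⟨ +-identityˡ (x - y) ⟩
      x - y                   ∎

  ι-⊖ : ∀ m n → ι (m ℤ.⊖ n) ≈ m × 1# - n × 1#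
  ι-⊖ m zero = begin
    ι (m ℤ.⊖ 0)     ≡⟨ P.cong ι (P.trans (P.sym (ℤP.m-n≡m⊖n m 0)) (ℤP.+-identityʳ (+ m))) ⟩
    m × 1#          ≈⟨ +-identityʳ (m × 1#) ⟨
    m × 1# + 0#     ≈⟨ +-congˡ -0#≈0# ⟨
    m × 1# - 0 × 1# ∎
  ι-⊖ zero (suc n) = sym (+-identityˡ _)
  ι-⊖ (suc m) (suc n) = begin
    ι (suc m ℤ.⊖ suc n)           ≡⟨ P.cong ι (ℤP.[1+m]⊖[1+n]≡m⊖n m n) ⟩
    ι (m ℤ.⊖ n)                   ≈⟨ ι-⊖ m n ⟩
    m × 1# - n × 1#               ≈⟨ 1+x-[1+y]≈x-y (m × 1#) (n × 1#) ⟨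
    (1# + m × 1#) - (1# + n × 1#) ≈⟨ +-cong (1+× m 1#) (-‿cong (1+× n 1#)) ⟨
    suc m × 1# - suc n × 1#       ∎

  ι-homo-+ : ∀ i j → ι (i ℤ.+ j) ≈ ι i + ι j
  ι-homo-+ (+ m)    (+ n)    = ×-homo-+ 1# m n
  ι-homo-+ (+ m)    -[1+ n ] = ι-⊖ m (suc n)
  ι-homo-+ -[1+ m ] (+ n)    = trans (ι-⊖ n (suc m)) (+-comm _ _)
  ι-homo-+ -[1+ m ] -[1+ n ] = begin
    - (suc (suc (m ℕ.+ n)) × 1#)      ≡⟨ P.cong (λ k → - (k × 1#)) (ℕP.+-suc (suc m) n) ⟨
    - ((suc m ℕ.+ suc n) × 1#)        ≈⟨ -‿cong (×-homo-+ 1# (suc m) (suc n)) ⟩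
    - (suc m × 1# + suc n × 1#)       ≈⟨ -‿+-comm _ _ ⟨
    - (suc m × 1#) + - (suc n × 1#)   ∎

  ι-homo-neg : ∀ i → ι (ℤ.- i) ≈ - ι i
  ι-homo-neg (+ zero)  = sym -0#≈0#
  ι-homo-neg (+ suc n) = refl
  ι-homo-neg -[1+ n ]  = sym (-‿involutive _)

  private
    ι-homo-*-pos : ∀ m j → ι (+ m ℤ.* j) ≈ ι (+ m) * ι j
    ι-homo-*-pos m (+ n) = trans (reflexive (P.cong ι (P.sym (ℤP.pos-* m n)))) (×1-homo-* m n)
    ι-homo-*-pos m -[1+ n ] = begin
      ι (+ m ℤ.* -[1+ n ])             ≡⟨ P.cong ι (ℤP.neg-distribʳ-* (+ m) (+ suc n)) ⟨
      ι (ℤ.- (+ m ℤ.* + suc n))        ≈⟨ ι-homo-neg (+ m ℤ.* + suc n) ⟩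
      - ι (+ m ℤ.* + suc n)            ≈⟨ -‿cong (ι-homo-*-pos m (+ suc n)) ⟩
      - (m × 1# * suc n × 1#)          ≈⟨ -‿distribʳ-* _ _ ⟩
      m × 1# * - (suc n × 1#)          ∎

  ι-homo-* : ∀ i j → ι (i ℤ.* j) ≈ ι i * ι j
  ι-homo-* (+ m)    j = ι-homo-*-pos m j
  ι-homo-* -[1+ m ] j = begin
    ι (-[1+ m ] ℤ.* j)               ≡⟨ P.cong ι (ℤP.neg-distribˡ-* (+ suc m) j) ⟨
    ι (ℤ.- (+ suc m ℤ.* j))          ≈⟨ ι-homo-neg (+ suc m ℤ.* j) ⟩
    - ι (+ suc m ℤ.* j)              ≈⟨ -‿cong (ι-homo-*-pos (suc m) j) ⟩
    - (suc m × 1# * ι j)             ≈⟨ -‿distribˡ-* _ _ ⟩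
    - (suc m × 1#) * ι j             ∎

  ι-morphism : ℤ.+-*-rawRing -Raw-AlmostCommutative⟶ fromCommutativeRing R
  ι-morphism = record
    { ⟦_⟧    = ι
    ; +-homo = ι-homo-+
    ; *-homo = ι-homo-*
    ; -‿homo = ι-homo-neg
    ; 0-homo = refl
    ; 1-homo = refl
    }

  ι-≈? : ∀ i j → Maybe (ι i ≈ ι j)
  ι-≈? i j with i ℤ.≟ j
  ... | yes i≡j = just (reflexive (P.cong ι i≡j))
  ... | no  _   = nothing

  module RingSolver = Algebra.Solver.Ring ℤ.+-*-rawRing (fromCommutativeRing R) ι-morphism ι-≈?

private
  j≡i+[j-i] : ∀ j i → j ≡ i ℤ.+ (j ℤ.- i)
  j≡i+[j-i] = solve-∀

≤⇒≡+ : ∀ {i j} → i ℤ.≤ j → ∃[ d ] j ≡ i ℤ.+ + d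
≤⇒≡+ {i} {j} i≤j =
  ℤ.∣ j ℤ.- i ∣ ,
  P.trans (j≡i+[j-i] j i) (P.cong (λ k → i ℤ.+ k) (P.sym (ℤP.0≤i⇒+∣i∣≡i (ℤP.i≤j⇒0≤j-i i≤j))))

i≤+∣i∣ : ∀ i → i ℤ.≤ + ℤ.∣ i ∣
i≤+∣i∣ (+ n)    = ℤP.≤-refl
i≤+∣i∣ -[1+ n ] = ℤ.-≤+

span : ℤ → ℤ → ℕ
span b X = suc ℤ.∣ X ℤ.- b ∣

X≤b+∣X-b∣ : ∀ X b → X ℤ.≤ b ℤ.+ + ℤ.∣ X ℤ.- b ∣
X≤b+∣X-b∣ X b =
  P.subst (ℤ._≤ b ℤ.+ + ℤ.∣ X ℤ.- b ∣) (P.sym (j≡i+[j-i] X b)) (ℤP.+-monoʳ-≤ b (i≤+∣i∣ (X ℤ.- b)))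

<+span : ∀ b X → X ℤ.< b ℤ.+ + span b X
<+span b X = ℤP.≤-<-trans (X≤b+∣X-b∣ X b) (ℤP.+-monoʳ-< b (ℤ.+<+ (ℕP.n<1+n _)))

i<j-k⇒k<j-i : ∀ {i j k} → i ℤ.< j ℤ.- k → k ℤ.< j ℤ.- i
i<j-k⇒k<j-i {i} {j} {k} i<j-k = P.subst₂ ℤ._<_ (eq₁ i k) (eq₂ i j k) (ℤP.+-monoˡ-< (k ℤ.- i) i<j-k)
  where
  eq₁ : ∀ i k → i ℤ.+ (k ℤ.- i) ≡ k
  eq₁ = solve-∀
  eq₂ : ∀ i j k → j ℤ.- k ℤ.+ (k ℤ.- i) ≡ j ℤ.- i
  eq₂ = solve-∀

i-+∣j∣≤i-j : ∀ i j → i ℤ.- + ℤ.∣ j ∣ ℤ.≤ i ℤ.- j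
i-+∣j∣≤i-j i j = ℤP.+-monoʳ-≤ i (ℤP.neg-mono-≤ (i≤+∣i∣ j))

a-∣a+b-n∣≤n-b : ∀ a b n → a ℤ.- + ℤ.∣ a ℤ.+ b ℤ.- n ∣ ℤ.≤ n ℤ.- b
a-∣a+b-n∣≤n-b a b n = P.subst (a ℤ.- + ℤ.∣ a ℤ.+ b ℤ.- n ∣ ℤ.≤_) (eq a b n) (i-+∣j∣≤i-j a (a ℤ.+ b ℤ.- n))
  where
  eq : ∀ a b n → a ℤ.- (a ℤ.+ b ℤ.- n) ≡ n ℤ.- b
  eq = solve-∀

a<a-L+[1+L] : ∀ a L → a ℤ.< a ℤ.- + L ℤ.+ + suc L
a<a-L+[1+L] a L = P.subst (a ℤ.<_) (eq a (+ L)) (ℤP.suc[i]≤j⇒i<j ℤP.≤-refl)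
  where
  eq : ∀ a L → 1ℤ ℤ.+ a ≡ a ℤ.- L ℤ.+ (1ℤ ℤ.+ L)
  eq = solve-∀

+[m∸n]≡+m-+n : ∀ {m n} → n ℕ.≤ m → + (m ℕ.∸ n) ≡ + m ℤ.- + n
+[m∸n]≡+m-+n {m} {n} n≤m = P.sym (P.trans (ℤP.m-n≡m⊖n m n) (ℤP.⊖-≥ n≤m))

c-b-∣X-b∣≤c-X : ∀ c b X → c ℤ.- b ℤ.- + ℤ.∣ X ℤ.- b ∣ ℤ.≤ c ℤ.- X
c-b-∣X-b∣≤c-X c b X =
  P.subst (c ℤ.- b ℤ.- + ℤ.∣ X ℤ.- b ∣ ℤ.≤_) (eq c b X) (i-+∣j∣≤i-j (c ℤ.- b) (X ℤ.- b))
  where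
  eq : ∀ c b X → c ℤ.- b ℤ.- (X ℤ.- b) ≡ c ℤ.- X
  eq = solve-∀

i+j<k⇒i<k-j : ∀ {i j k} → i ℤ.+ j ℤ.< k → i ℤ.< k ℤ.- j
i+j<k⇒i<k-j {i} {j} {k} i+j<k = P.subst (ℤ._< k ℤ.- j) (eq i j) (ℤP.+-monoˡ-< (ℤ.- j) i+j<k)
  where
  eq : ∀ i j → i ℤ.+ j ℤ.- j ≡ i
  eq = solve-∀

-[1+∣i∣]<i : ∀ i → ℤ.- + suc ℤ.∣ i ∣ ℤ.< i
-[1+∣i∣]<i (+ n)    = ℤ.-<+
-[1+∣i∣]<i -[1+ n ] = ℤ.-<- (ℕP.n<1+n n)

i<i+[1+n] : ∀ i n → i ℤ.< i ℤ.+ + suc n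
i<i+[1+n] i n = P.subst (ℤ._< i ℤ.+ + suc n) (ℤP.+-identityʳ i) (ℤP.+-monoʳ-< i (ℤ.+<+ (ℕ.s≤s ℕ.z≤n)))

pred[i]<i : ∀ i → ℤ.pred i ℤ.< i
pred[i]<i i = P.subst (ℤ.pred i ℤ.<_) (eq i) (i<i+[1+n] (ℤ.pred i) 0)
  where
  eq : ∀ i → ℤ.-1ℤ ℤ.+ i ℤ.+ 1ℤ ≡ i
  eq = solve-∀

module Series (F : FiniteField) where

  open import Data.Product using (_×_)
  open FiniteField F hiding (zero)
  open Laurent F
  open import Algebra.Properties.Semiring.Sum semiring
    using (sum; sum-cong-≋; sum-replicate-zero; ∑-permute; ∑-comm; ∑-distrib-+; *-distribˡ-sum; *-distribʳ-sum)
  open import Relation.Binary.Reasoning.Setoid setoid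

  VanishesBelow : (ℤ → Carrier) → ℤ → Set
  VanishesBelow g b = ∀ j → j ℤ.< b → g j ≈ 0#

  VanishesFrom : (ℤ → Carrier) → ℤ → Set
  VanishesFrom g h = ∀ j → h ℤ.≤ j → g j ≈ 0#

  VanishesOutside : (ℤ → Carrier) → ℤ → ℕ → Set
  VanishesOutside g b m = VanishesBelow g b × VanishesFrom g (b ℤ.+ + m)

  window : ℤ → ℕ → (ℤ → Carrier) → Carrier
  window b m g = sum {m} λ t → g (b ℤ.+ + toℕ t)

  window-cong : ∀ b m (g h : ℤ → Carrier) → (∀ t → t ℕ.< m → g (b ℤ.+ + t) ≈ h (b ℤ.+ + t)) →
                window b m g ≈ window b m h
  window-cong b m g h g≈h = sum-cong-≋ {m} λ t → g≈h (toℕ t) (FinP.toℕ<n t)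

  window-shift : ∀ b b' m (g h : ℤ → Carrier) → (∀ t → g (b ℤ.+ + t) ≈ h (b' ℤ.+ + t)) →
                 window b m g ≈ window b' m h
  window-shift b b' m g h g≈h = sum-cong-≋ {m} λ t → g≈h (toℕ t)

  window-≡ : ∀ {b b'} m g → b ≡ b' → window b m g ≈ window b' m g
  window-≡ m g P.refl = refl

  module _ {g : ℤ → Carrier} where

    window-zero : ∀ b m → (∀ t → t ℕ.< m → g (b ℤ.+ + t) ≈ 0#) → window b m g ≈ 0#
    window-zero b m g≈0 = trans (window-cong b m g (λ _ → 0#) g≈0) (sum-replicate-zero m)

    window-peel : ∀ b m → window b (suc m) g ≈ g b + window (b ℤ.+ 1ℤ) m g
    window-peel b m = +-cong (reflexive (P.cong g (ℤP.+-identityʳ b)))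
                             (sum-cong-≋ {m} λ t → reflexive (P.cong g (shift (toℕ t))))
      where
      shift : ∀ t → b ℤ.+ + suc t ≡ b ℤ.+ 1ℤ ℤ.+ + t
      shift t = P.trans (P.cong (λ k → b ℤ.+ k) (ℤP.pos-+ 1 t)) (P.sym (ℤP.+-assoc b 1ℤ (+ t)))

    window-++ : ∀ b d m → window b (d ℕ.+ m) g ≈ window b d g + window (b ℤ.+ + d) m g
    window-++ b zero m = begin
      window b m g                    ≈⟨ window-≡ m g (ℤP.+-identityʳ b) ⟨
      window (b ℤ.+ + 0) m g          ≈⟨ +-identityˡ _ ⟨
      0# + window (b ℤ.+ + 0) m g     ∎
    window-++ b (suc d) m = begin
      window b (suc (d ℕ.+ m)) g
        ≈⟨ window-peel b (d ℕ.+ m) ⟩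
      g b + window (b ℤ.+ 1ℤ) (d ℕ.+ m) g
        ≈⟨ +-congˡ (window-++ (b ℤ.+ 1ℤ) d m) ⟩
      g b + (window (b ℤ.+ 1ℤ) d g + window (b ℤ.+ 1ℤ ℤ.+ + d) m g)
        ≈⟨ +-assoc _ _ _ ⟨
      (g b + window (b ℤ.+ 1ℤ) d g) + window (b ℤ.+ 1ℤ ℤ.+ + d) m g
        ≈⟨ +-cong (window-peel b d) (window-≡ m g (base b (+ d))) ⟨
      window b (suc d) g + window (b ℤ.+ + suc d) m g
        ∎
      where
      base : ∀ b d → b ℤ.+ (1ℤ ℤ.+ d) ≡ b ℤ.+ 1ℤ ℤ.+ d
      base = solve-∀

    window-extend : ∀ b m e → VanishesFrom g (b ℤ.+ + m) → window b (m ℕ.+ e) g ≈ window b m g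
    window-extend b m e from = begin
      window b (m ℕ.+ e) g                    ≈⟨ window-++ b m e ⟩
      window b m g + window (b ℤ.+ + m) e g   ≈⟨ +-congˡ (window-zero (b ℤ.+ + m) e λ t _ → from _ (ℤP.i≤i+j _ (+ t))) ⟩
      window b m g + 0#                       ≈⟨ +-identityʳ _ ⟩
      window b m g                            ∎

    window-pad : ∀ b d m e → VanishesBelow g (b ℤ.+ + d) → VanishesFrom g (b ℤ.+ + d ℤ.+ + m) →
                 window b (d ℕ.+ (m ℕ.+ e)) g ≈ window (b ℤ.+ + d) m g
    window-pad b d m e below from = begin
      window b (d ℕ.+ (m ℕ.+ e)) g
        ≈⟨ window-++ b d (m ℕ.+ e) ⟩
      window b d g + window (b ℤ.+ + d) (m ℕ.+ e) g
        ≈⟨ +-cong (window-zero b d λ t t<d → below _ (ℤP.+-monoʳ-< b (ℤ.+<+ t<d))) (window-extend (b ℤ.+ + d) m e from) ⟩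
      0# + window (b ℤ.+ + d) m g
        ≈⟨ +-identityˡ _ ⟩
      window (b ℤ.+ + d) m g
        ∎

    private
      window-unique-≤ : ∀ {b b'} m m' → b ℤ.≤ b' →
                        VanishesOutside g b m → VanishesOutside g b' m' →
                        window b m g ≈ window b' m' g
      window-unique-≤ {b} m m' b≤b' (_ , from) (below' , from') with ≤⇒≡+ b≤b'
      ... | d , P.refl = begin
        window b m g                      ≈⟨ window-extend b m (d ℕ.+ m') from ⟨
        window b (m ℕ.+ (d ℕ.+ m')) g     ≡⟨ P.cong (λ k → window b k g) (m+[d+m′]≡d+[m′+m] m d m') ⟩
        window b (d ℕ.+ (m' ℕ.+ m)) g     ≈⟨ window-pad b d m' m below' from' ⟩
        window (b ℤ.+ + d) m' g           ∎
        where
        m+[d+m′]≡d+[m′+m] : ∀ m d m' → m ℕ.+ (d ℕ.+ m') ≡ d ℕ.+ (m' ℕ.+ m)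
        m+[d+m′]≡d+[m′+m] m d m' = P.trans (ℕP.+-comm m (d ℕ.+ m')) (ℕP.+-assoc d m' m)

    window-unique : ∀ {b b'} m m' → VanishesOutside g b m → VanishesOutside g b' m' →
                    window b m g ≈ window b' m' g
    window-unique {b} {b'} m m' out out' with ℤP.≤-total b b'
    ... | inj₁ b≤b' = window-unique-≤ m m' b≤b' out out'
    ... | inj₂ b'≤b = sym (window-unique-≤ m' m b'≤b out' out)

  window-reverse : ∀ c b L g → window b (suc L) (λ j → g (c ℤ.- j)) ≈ window (c ℤ.- b ℤ.- + L) (suc L) g
  window-reverse c b L g = begin
    sum {suc L} (λ i → g (c ℤ.- (b ℤ.+ + toℕ i)))
      ≈⟨ ∑-permute {suc L} (λ i → g (c ℤ.- (b ℤ.+ + toℕ i))) reverse ⟩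
    sum {suc L} (λ i → g (c ℤ.- (b ℤ.+ + toℕ (Fin.opposite i))))
      ≈⟨ sum-cong-≋ {suc L} (λ i → reflexive (P.cong g (reindex i))) ⟩
    sum {suc L} (λ i → g (c ℤ.- b ℤ.- + L ℤ.+ + toℕ i))
      ∎
    where
    eq : ∀ c b l t → c ℤ.- (b ℤ.+ (l ℤ.- t)) ≡ c ℤ.- b ℤ.- l ℤ.+ t
    eq = solve-∀
    reindex : ∀ i → c ℤ.- (b ℤ.+ + toℕ (Fin.opposite i)) ≡ c ℤ.- b ℤ.- + L ℤ.+ + toℕ i
    reindex i = P.trans (P.cong (λ k → c ℤ.- (b ℤ.+ + k)) (FinP.opposite-prop i))
                (P.trans (P.cong (λ k → c ℤ.- (b ℤ.+ k)) (+[m∸n]≡+m-+n (FinP.toℕ≤pred[n] i)))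
                         (eq c b (+ L) (+ toℕ i)))

  AbsLe-mono : ∀ {x e e'} → AbsLe x e → e ℤ.≤ e' → AbsLe x e'
  AbsLe-mono x≤e e≤e' j e'<j = x≤e j (ℤP.≤-<-trans e≤e' e'<j)

  cauchyTerm : LS → LS → ℤ → ℤ → Carrier
  cauchyTerm x y n j = coef x j * coef y (n ℤ.- j)

  module _ {x y : LS} {n : ℤ} where

    cauchyTerm-vanishesAbove : ∀ {Bx} → AbsLe x Bx → ∀ j → Bx ℤ.< j → cauchyTerm x y n j ≈ 0#
    cauchyTerm-vanishesAbove x≤Bx j Bx<j = trans (*-congʳ (x≤Bx j Bx<j)) (zeroˡ _)

    cauchyTerm-vanishesBelow : ∀ {By} → AbsLe y By → VanishesBelow (cauchyTerm x y n) (n ℤ.- By)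
    cauchyTerm-vanishesBelow {By} y≤By j j<n-By = trans (*-congˡ (y≤By _ By<n-j)) (zeroʳ _)
      where
      By<n-j : By ℤ.< n ℤ.- j
      By<n-j = i<j-k⇒k<j-i {j = n} j<n-By

    cauchyTerm-vanishesFrom : ∀ {Bx b} → AbsLe x Bx → Bx ℤ.< b → VanishesFrom (cauchyTerm x y n) b
    cauchyTerm-vanishesFrom x≤Bx Bx<b j b≤j = cauchyTerm-vanishesAbove x≤Bx j (ℤP.<-≤-trans Bx<b b≤j)

  private
    sumDefs : ℕ → (ℕ → Carrier) → Carrier
    sumDefs zero    f = 0#
    sumDefs (suc m) f = f m + sumDefs m f

    sumDefs-unique : (T : ℕ → (ℕ → Carrier) → Carrier) →
                     (∀ f → T 0 f ≡ 0#) → (∀ m f → T (suc m) f ≡ f m + T m f) →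
                     ∀ m f → T m f ≡ sumDefs m f
    sumDefs-unique T T0 Tsuc zero    f = T0 f
    sumDefs-unique T T0 Tsuc (suc m) f = P.trans (Tsuc m f) (P.cong (λ s → f m + s) (sumDefs-unique T T0 Tsuc m f))

    sumDefs-descending : ∀ m f → sumDefs m f ≡ sum {m} (λ i → f (m ∸ suc (toℕ i)))
    sumDefs-descending zero    f = P.refl
    sumDefs-descending (suc m) f = P.cong (λ s → f m + s) (sumDefs-descending m f)

    -- Defs sums a Cauchy product with a private recursion. Abstracting the length and the summand
    -- applies that function to variables, so unification can supply it as T in sumDefs-unique.
    coef-*L-sumDefs : ∀ x y n → coef (x *L y) n ≡
      sumDefs (suc ℤ.∣ bnd x ℤ.+ bnd y ℤ.- n ∣) (λ i → coef x (bnd x ℤ.- + i) * coef y (n ℤ.- bnd x ℤ.+ + i))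
    coef-*L-sumDefs x y n = unfold (sumDefs-unique _ (λ _ → P.refl) (λ _ _ → P.refl))
      where
      unfold : (∀ m f → _ ≡ sumDefs m f) → coef (x *L y) n ≡
        sumDefs (suc ℤ.∣ bnd x ℤ.+ bnd y ℤ.- n ∣) (λ i → coef x (bnd x ℤ.- + i) * coef y (n ℤ.- bnd x ℤ.+ + i))
      unfold T≡sumDefs with ℤ.∣ bnd x ℤ.+ bnd y ℤ.- n ∣ | (λ i → coef x (bnd x ℤ.- + i) * coef y (n ℤ.- bnd x ℤ.+ + i))
      ... | L | f = P.cong₂ _+_ P.refl (T≡sumDefs L f)

    coef-*L-window : ∀ x y n → let L = ℤ.∣ bnd x ℤ.+ bnd y ℤ.- n ∣ in
                     coef (x *L y) n ≈ window (bnd x ℤ.- + L) (suc L) (cauchyTerm x y n)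
    coef-*L-window x y n = begin
      coef (x *L y) n
        ≡⟨ P.trans (coef-*L-sumDefs x y n) (sumDefs-descending (suc L) _) ⟩
      sum {suc L} (λ i → term (L ∸ toℕ i))
        ≈⟨ sum-cong-≋ {suc L} (λ i → reflexive (reindex (toℕ i) (FinP.toℕ≤pred[n] i))) ⟩
      window b (suc L) (cauchyTerm x y n)
        ∎
      where
      L : ℕ
      L = ℤ.∣ bnd x ℤ.+ bnd y ℤ.- n ∣
      b : ℤ
      b = bnd x ℤ.- + L
      term : ℕ → Carrier
      term i = coef x (bnd x ℤ.- + i) * coef y (n ℤ.- bnd x ℤ.+ + i)
      eq₁ : ∀ a l t → a ℤ.- (l ℤ.- t) ≡ a ℤ.- l ℤ.+ t
      eq₁ = solve-∀
      eq₂ : ∀ n a l t → n ℤ.- a ℤ.+ (l ℤ.- t) ≡ n ℤ.- (a ℤ.- l ℤ.+ t)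
      eq₂ = solve-∀
      reindex : ∀ t → t ℕ.≤ L → term (L ∸ t) ≡ cauchyTerm x y n (b ℤ.+ + t)
      reindex t t≤L rewrite +[m∸n]≡+m-+n t≤L =
        P.cong₂ (λ i j → coef x i * coef y j) (eq₁ (bnd x) (+ L) (+ t)) (eq₂ n (bnd x) (+ L) (+ t))

  coef-*L : ∀ {x y Bx} n b m → AbsLe x Bx → VanishesBelow (cauchyTerm x y n) b → Bx ℤ.< b ℤ.+ + m →
            coef (x *L y) n ≈ window b m (cauchyTerm x y n)
  coef-*L {x} {y} n b m x≤Bx below Bx<b+m =
    trans (coef-*L-window x y n) (window-unique (suc L) m (below-raw , from-raw) (below , from))
    where
    L : ℕ
    L = ℤ.∣ bnd x ℤ.+ bnd y ℤ.- n ∣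
    below-raw : VanishesBelow (cauchyTerm x y n) (bnd x ℤ.- + L)
    below-raw j j<b = cauchyTerm-vanishesBelow {x} {y} {n} (vanish y) j (ℤP.<-≤-trans j<b (a-∣a+b-n∣≤n-b (bnd x) (bnd y) n))
    from-raw : VanishesFrom (cauchyTerm x y n) (bnd x ℤ.- + L ℤ.+ + suc L)
    from-raw = cauchyTerm-vanishesFrom {x} {y} {n} (vanish x) (a<a-L+[1+L] (bnd x) L)
    from : VanishesFrom (cauchyTerm x y n) (b ℤ.+ + m)
    from = cauchyTerm-vanishesFrom {x} {y} {n} x≤Bx Bx<b+m

  coef-*L-bounded : ∀ {x y Bx By} n → AbsLe x Bx → AbsLe y By →
                    coef (x *L y) n ≈ window (n ℤ.- By) (span (n ℤ.- By) Bx) (cauchyTerm x y n)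
  coef-*L-bounded {x} {y} {Bx} {By} n x≤Bx y≤By =
    coef-*L {x} {y} n (n ℤ.- By) _ x≤Bx (cauchyTerm-vanishesBelow {x} {y} {n} y≤By) (<+span (n ℤ.- By) Bx)

  -- The commutative ring of Laurent series

  ≈L-isEquivalence : IsEquivalence _≈L_
  ≈L-isEquivalence = record
    { refl  = λ _ → refl
    ; sym   = λ x≈y j → sym (x≈y j)
    ; trans = λ x≈y y≈z j → trans (x≈y j) (y≈z j)
    }

  ≈L-setoid : Setoid 0ℓ 0ℓ
  ≈L-setoid = record { isEquivalence = ≈L-isEquivalence }

  *L-cong : ∀ {x x' y y'} → x ≈L x' → y ≈L y' → (x *L y) ≈L (x' *L y')
  *L-cong {x} {x'} {y} {y'} x≈x' y≈y' n = begin
    coef (x *L y) n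
      ≈⟨ coef-*L-bounded {x} {y} n x≤Bx y≤By ⟩
    window b m (cauchyTerm x y n)
      ≈⟨ window-cong b m (cauchyTerm x y n) (cauchyTerm x' y' n) (λ t _ → *-cong (x≈x' _) (y≈y' _)) ⟩
    window b m (cauchyTerm x' y' n)
      ≈⟨ coef-*L-bounded {x'} {y'} n x'≤Bx y'≤By ⟨
    coef (x' *L y') n
      ∎
    where
    Bx By b : ℤ
    Bx = bnd x ℤ.⊔ bnd x'
    By = bnd y ℤ.⊔ bnd y'
    b = n ℤ.- By
    m : ℕ
    m = span b Bx
    x≤Bx : AbsLe x Bx
    x≤Bx = AbsLe-mono {x} (vanish x) (ℤP.i≤i⊔j (bnd x) (bnd x'))
    x'≤Bx : AbsLe x' Bx
    x'≤Bx = AbsLe-mono {x'} (vanish x') (ℤP.i≤j⊔i (bnd x) (bnd x'))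
    y≤By : AbsLe y By
    y≤By = AbsLe-mono {y} (vanish y) (ℤP.i≤i⊔j (bnd y) (bnd y'))
    y'≤By : AbsLe y' By
    y'≤By = AbsLe-mono {y'} (vanish y') (ℤP.i≤j⊔i (bnd y) (bnd y'))

  *L-comm : ∀ x y → (x *L y) ≈L (y *L x)
  *L-comm x y n = begin
    coef (x *L y) n
      ≈⟨ coef-*L-bounded {x} {y} n (vanish x) (vanish y) ⟩
    window b (suc L) (cauchyTerm x y n)
      ≈⟨ window-cong b (suc L) (cauchyTerm x y n) (λ j → cauchyTerm y x n (n ℤ.- j)) (λ t _ → swap (b ℤ.+ + t)) ⟩
    window b (suc L) (λ j → cauchyTerm y x n (n ℤ.- j))
      ≈⟨ window-reverse n b L (cauchyTerm y x n) ⟩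
    window (n ℤ.- b ℤ.- + L) (suc L) (cauchyTerm y x n)
      ≈⟨ coef-*L {y} {x} n _ (suc L) (vanish y) below by<top ⟨
    coef (y *L x) n
      ∎
    where
    b : ℤ
    b = n ℤ.- bnd y
    L : ℕ
    L = ℤ.∣ bnd x ℤ.- b ∣
    n-[n-j]≡j : ∀ n j → n ℤ.- (n ℤ.- j) ≡ j
    n-[n-j]≡j = solve-∀
    swap : ∀ j → cauchyTerm x y n j ≈ cauchyTerm y x n (n ℤ.- j)
    swap j = trans (*-comm _ _) (*-congˡ (reflexive (P.cong (coef x) (P.sym (n-[n-j]≡j n j)))))
    below : VanishesBelow (cauchyTerm y x n) (n ℤ.- b ℤ.- + L)
    below j j<top = cauchyTerm-vanishesBelow {y} {x} {n} (vanish x) j (ℤP.<-≤-trans j<top (c-b-∣X-b∣≤c-X n b (bnd x)))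
    by<top : bnd y ℤ.< n ℤ.- b ℤ.- + L ℤ.+ + suc L
    by<top = P.subst (λ a → bnd y ℤ.< a ℤ.- + L ℤ.+ + suc L) (P.sym (n-[n-j]≡j n (bnd y))) (a<a-L+[1+L] (bnd y) L)

  module TripleProduct (x y z : LS) (n : ℤ) where

    bx by bz c : ℤ
    bx = bnd x
    by = bnd y
    bz = bnd z
    c = n ℤ.- bz ℤ.- by
    W : ℕ
    W = span c bx
    inner : ℤ → ℤ → Carrier
    inner i j = coef y (j ℤ.- i) * coef z (n ℤ.- j)
    triple : ℤ → ℤ → Carrier
    triple i j = coef x i * inner i j

    coef-[xy]z : coef ((x *L y) *L z) n ≈ sum {W} (λ s → sum {W} (λ t → triple (c ℤ.+ + toℕ t) (n ℤ.- bz ℤ.+ + toℕ s)))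
    coef-[xy]z = begin
      coef ((x *L y) *L z) n
        ≈⟨ coef-*L {x *L y} {z} n (n ℤ.- bz) W (vanish (x *L y)) (cauchyTerm-vanishesBelow {x *L y} {z} {n} (vanish z)) bxy<top ⟩
      window (n ℤ.- bz) W (cauchyTerm (x *L y) z n)
        ≈⟨ window-cong (n ℤ.- bz) W (cauchyTerm (x *L y) z n) (λ j → window c W (cauchyTerm x y j) * coef z (n ℤ.- j))
             (λ t _ → *-congʳ (coef-*L {x} {y} _ c W (vanish x) (below-xy t) (<+span c bx))) ⟩
      window (n ℤ.- bz) W (λ j → window c W (cauchyTerm x y j) * coef z (n ℤ.- j))
        ≈⟨ sum-cong-≋ {W} (λ s → distribute (n ℤ.- bz ℤ.+ + toℕ s)) ⟩
      sum {W} (λ s → sum {W} (λ t → triple (c ℤ.+ + toℕ t) (n ℤ.- bz ℤ.+ + toℕ s)))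
        ∎
      where
      bxy<top : bx ℤ.+ by ℤ.< n ℤ.- bz ℤ.+ + W
      bxy<top = P.subst (bx ℤ.+ by ℤ.<_) (eq n bz by (+ W)) (ℤP.+-monoˡ-< by (<+span c bx))
        where
        eq : ∀ n bz by w → n ℤ.- bz ℤ.- by ℤ.+ w ℤ.+ by ≡ n ℤ.- bz ℤ.+ w
        eq = solve-∀
      below-xy : ∀ t → VanishesBelow (cauchyTerm x y (n ℤ.- bz ℤ.+ + t)) c
      below-xy t j j<c = cauchyTerm-vanishesBelow {x} {y} {n ℤ.- bz ℤ.+ + t} (vanish y) j
        (ℤP.<-≤-trans j<c (P.subst (c ℤ.≤_) (eq n bz by (+ t)) (ℤP.i≤i+j c (+ t))))
        where
        eq : ∀ n bz by t → n ℤ.- bz ℤ.- by ℤ.+ t ≡ n ℤ.- bz ℤ.+ t ℤ.- by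
        eq = solve-∀
      distribute : ∀ j → window c W (cauchyTerm x y j) * coef z (n ℤ.- j) ≈ window c W (λ i → triple i j)
      distribute j = trans (*-distribʳ-sum {W} (coef z (n ℤ.- j)) (λ t → cauchyTerm x y j (c ℤ.+ + toℕ t)))
        (sum-cong-≋ {W} λ t → *-assoc (coef x (c ℤ.+ + toℕ t)) (coef y (j ℤ.- (c ℤ.+ + toℕ t))) (coef z (n ℤ.- j)))

    coef-x[yz] : coef (x *L (y *L z)) n ≈ sum {W} (λ t → sum {W} (λ s → triple (c ℤ.+ + toℕ t) (n ℤ.- bz ℤ.+ + toℕ s)))
    coef-x[yz] = begin
      coef (x *L (y *L z)) n
        ≈⟨ coef-*L {x} {y *L z} n c W (vanish x) below-x[yz] (<+span c bx) ⟩
      window c W (cauchyTerm x (y *L z) n)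
        ≈⟨ window-cong c W (cauchyTerm x (y *L z) n) (λ i → coef x i * window (n ℤ.- bz) W (inner i))
             (λ t t<W → *-congˡ (trans (coef-yz t t<W) (sym (shift (c ℤ.+ + t))))) ⟩
      window c W (λ i → coef x i * window (n ℤ.- bz) W (inner i))
        ≈⟨ sum-cong-≋ {W} (λ t → *-distribˡ-sum {W} (coef x (c ℤ.+ + toℕ t))
                                                      (λ s → inner (c ℤ.+ + toℕ t) (n ℤ.- bz ℤ.+ + toℕ s))) ⟩
      sum {W} (λ t → sum {W} (λ s → triple (c ℤ.+ + toℕ t) (n ℤ.- bz ℤ.+ + toℕ s)))
        ∎
      where
      below-x[yz] : VanishesBelow (cauchyTerm x (y *L z) n) c
      below-x[yz] j j<c = cauchyTerm-vanishesBelow {x} {y *L z} {n} (vanish (y *L z)) j (P.subst (j ℤ.<_) (eq n by bz) j<c)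
        where
        eq : ∀ n by bz → n ℤ.- bz ℤ.- by ≡ n ℤ.- (by ℤ.+ bz)
        eq = solve-∀
      coef-yz : ∀ t → t ℕ.< W →
                coef (y *L z) (n ℤ.- (c ℤ.+ + t)) ≈
                window (n ℤ.- (c ℤ.+ + t) ℤ.- bz) W (cauchyTerm y z (n ℤ.- (c ℤ.+ + t)))
      coef-yz t t<W = coef-*L {y} {z} _ _ W (vanish y) (cauchyTerm-vanishesBelow {y} {z} {n ℤ.- (c ℤ.+ + t)} (vanish z))
        (P.subst₂ ℤ._<_ (eq₁ by (+ t)) (eq₂ n bz by (+ t) (+ W))
                        (ℤP.+-monoˡ-< (ℤ.- + t) (ℤP.+-monoʳ-< by (ℤ.+<+ t<W))))
        where
        eq₁ : ∀ by t → by ℤ.+ t ℤ.- t ≡ by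
        eq₁ = solve-∀
        eq₂ : ∀ n bz by t w → by ℤ.+ w ℤ.- t ≡ n ℤ.- (n ℤ.- bz ℤ.- by ℤ.+ t) ℤ.- bz ℤ.+ w
        eq₂ = solve-∀
      shift : ∀ i → window (n ℤ.- bz) W (inner i) ≈ window (n ℤ.- i ℤ.- bz) W (cauchyTerm y z (n ℤ.- i))
      shift i = window-shift (n ℤ.- bz) (n ℤ.- i ℤ.- bz) W (inner i) (cauchyTerm y z (n ℤ.- i))
        λ t → reflexive (P.cong₂ (λ k l → coef y k * coef z l) (eq₁ n bz i (+ t)) (eq₂ n bz i (+ t)))
        where
        eq₁ : ∀ n bz i t → n ℤ.- bz ℤ.+ t ℤ.- i ≡ n ℤ.- i ℤ.- bz ℤ.+ t
        eq₁ = solve-∀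
        eq₂ : ∀ n bz i t → n ℤ.- (n ℤ.- bz ℤ.+ t) ≡ n ℤ.- i ℤ.- (n ℤ.- i ℤ.- bz ℤ.+ t)
        eq₂ = solve-∀

  *L-assoc : ∀ x y z → ((x *L y) *L z) ≈L (x *L (y *L z))
  *L-assoc x y z n =
    trans coef-[xy]z (trans (∑-comm {W} {W} (λ s t → triple (c ℤ.+ + toℕ t) (n ℤ.- bz ℤ.+ + toℕ s))) (sym coef-x[yz]))
    where open TripleProduct x y z n

  *L-distribˡ-+L : ∀ x y z → (x *L (y +L z)) ≈L ((x *L y) +L (x *L z))
  *L-distribˡ-+L x y z n = begin
    coef (x *L (y +L z)) n
      ≈⟨ coef-*L-bounded {x} {y +L z} n (vanish x) (vanish (y +L z)) ⟩
    window b m (cauchyTerm x (y +L z) n)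
      ≈⟨ window-cong b m (cauchyTerm x (y +L z) n) (λ j → cauchyTerm x y n j + cauchyTerm x z n j)
                     (λ t _ → distribˡ _ _ _) ⟩
    window b m (λ j → cauchyTerm x y n j + cauchyTerm x z n j)
      ≈⟨ ∑-distrib-+ {m} (λ t → cauchyTerm x y n (b ℤ.+ + toℕ t)) (λ t → cauchyTerm x z n (b ℤ.+ + toℕ t)) ⟩
    window b m (cauchyTerm x y n) + window b m (cauchyTerm x z n)
      ≈⟨ +-cong (coef-*L-bounded {x} {y} n (vanish x) y≤B) (coef-*L-bounded {x} {z} n (vanish x) z≤B) ⟨
    coef (x *L y) n + coef (x *L z) n
      ∎
    where
    B : ℤ
    B = bnd y ℤ.⊔ bnd z
    b : ℤ
    b = n ℤ.- B
    m : ℕ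
    m = span b (bnd x)
    y≤B : AbsLe y B
    y≤B = AbsLe-mono {y} (vanish y) (ℤP.i≤i⊔j (bnd y) (bnd z))
    z≤B : AbsLe z B
    z≤B = AbsLe-mono {z} (vanish z) (ℤP.i≤j⊔i (bnd y) (bnd z))

  1L-vanishes-off-0 : ∀ j → ¬ j ≡ + 0 → coef 1L j ≈ 0#
  1L-vanishes-off-0 j j≢0 with j ℤ.≟ + 0
  ... | yes j≡0 = contradiction j≡0 j≢0
  ... | no _    = refl

  *L-identityˡ : ∀ x → (1L *L x) ≈L x
  *L-identityˡ x n = begin
    coef (1L *L x) n                  ≈⟨ coef-*L {1L} {x} n (+ 0) 1 (vanish 1L) below (ℤP.suc[i]≤j⇒i<j ℤP.≤-refl) ⟩
    1# * coef x (n ℤ.- + 0) + 0#      ≈⟨ +-identityʳ _ ⟩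
    1# * coef x (n ℤ.- + 0)           ≈⟨ *-identityˡ _ ⟩
    coef x (n ℤ.- + 0)                ≡⟨ P.cong (coef x) (ℤP.+-identityʳ n) ⟩
    coef x n                          ∎
    where
    below : VanishesBelow (cauchyTerm 1L x n) (+ 0)
    below j j<0 = trans (*-congʳ (1L-vanishes-off-0 j (ℤP.<⇒≢ j<0))) (zeroˡ _)

  LS-isCommutativeRing : IsCommutativeRing _≈L_ _+L_ _*L_ -L_ 0L 1L
  LS-isCommutativeRing = record
    { isRing = record
      { +-isAbelianGroup = record
        { isGroup = record
          { isMonoid = record
            { isSemigroup = record
              { isMagma = record
                { isEquivalence = ≈L-isEquivalence
                ; ∙-cong        = λ {x} {x'} {y} {y'} → +L-cong {x} {x'} {y} {y'}
                }
              ; assoc = λ x y z j → +-assoc (coef x j) (coef y j) (coef z j)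
              }
            ; identity = (λ x j → +-identityˡ (coef x j)) , (λ x j → +-identityʳ (coef x j))
            }
          ; inverse = (λ x j → -‿inverseˡ (coef x j)) , (λ x j → -‿inverseʳ (coef x j))
          ; ⁻¹-cong = λ {x} {x'} x≈x' j → -‿cong (x≈x' j)
          }
        ; comm = λ x y j → +-comm (coef x j) (coef y j)
        }
      ; *-cong     = λ {x} {x'} {y} {y'} → *L-cong {x} {x'} {y} {y'}
      ; *-assoc    = *L-assoc
      ; *-identity = comm∧idˡ⇒id {_*L_} *L-comm {1L} *L-identityˡ
      ; distrib    = comm∧distrˡ⇒distr {_*L_} {_+L_} (λ {x} {x'} {y} {y'} → +L-cong {x} {x'} {y} {y'}) *L-comm *L-distribˡ-+L
      }
    ; *-comm = *L-comm
    }
    where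
    open import Algebra.Consequences.Setoid ≈L-setoid
    +L-cong : ∀ {x x' y y'} → x ≈L x' → y ≈L y' → (x +L y) ≈L (x' +L y')
    +L-cong x≈x' y≈y' j = +-cong (x≈x' j) (y≈y' j)

  LS-commutativeRing : CommutativeRing 0ℓ 0ℓ
  LS-commutativeRing = record { isCommutativeRing = LS-isCommutativeRing }

  *-nonzero : ∀ {a b} → ¬ a ≈ 0# → ¬ b ≈ 0# → ¬ a * b ≈ 0#
  *-nonzero {a} {b} a≉0 b≉0 ab≈0 with inverse a a≉0
  ... | a⁻¹ , aa⁻¹≈1 = b≉0 (begin
    b               ≈⟨ *-identityˡ b ⟨
    1# * b          ≈⟨ *-congʳ aa⁻¹≈1 ⟨
    (a * a⁻¹) * b   ≈⟨ *-congʳ (*-comm a a⁻¹) ⟩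
    (a⁻¹ * a) * b   ≈⟨ *-assoc a⁻¹ a b ⟩
    a⁻¹ * (a * b)   ≈⟨ *-congˡ ab≈0 ⟩
    a⁻¹ * 0#        ≈⟨ zeroʳ a⁻¹ ⟩
    0#              ∎)

  module _ (x y : LS) where

    AbsLe-resp-≈L : ∀ {e} → x ≈L y → AbsLe x e → AbsLe y e
    AbsLe-resp-≈L x≈y x≤e j e<j = trans (sym (x≈y j)) (x≤e j e<j)

    IsDeg-resp-≈L : ∀ {d} → x ≈L y → IsDeg x d → IsDeg y d
    IsDeg-resp-≈L {d} x≈y (x≉0 , x≤d) = (λ y≈0 → x≉0 (trans (x≈y d) y≈0)) , AbsLe-resp-≈L x≈y x≤d

    AbsLe-+L : ∀ {e} → AbsLe x e → AbsLe y e → AbsLe (x +L y) e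
    AbsLe-+L x≤e y≤e j e<j = trans (+-cong (x≤e j e<j) (y≤e j e<j)) (+-identityˡ 0#)

    AbsLe-*L : ∀ {e₁ e₂} → AbsLe x e₁ → AbsLe y e₂ → AbsLe (x *L y) (e₁ ℤ.+ e₂)
    AbsLe-*L {e₁} {e₂} x≤e₁ y≤e₂ n e₁+e₂<n = trans (coef-*L-bounded {x} {y} n x≤e₁ y≤e₂)
      (window-zero {cauchyTerm x y n} (n ℤ.- e₂) (span (n ℤ.- e₂) e₁) λ t _ → cauchyTerm-vanishesAbove {x} {y} {n} x≤e₁ _
        (ℤP.<-≤-trans (i+j<k⇒i<k-j e₁+e₂<n) (ℤP.i≤i+j (n ℤ.- e₂) (+ t))))

    coef-*L-top : ∀ {d₁ d₂} → AbsLe x d₁ → AbsLe y d₂ → coef (x *L y) (d₁ ℤ.+ d₂) ≈ coef x d₁ * coef y d₂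
    coef-*L-top {d₁} {d₂} x≤d₁ y≤d₂ = begin
      coef (x *L y) (d₁ ℤ.+ d₂)
        ≈⟨ coef-*L {x} {y} _ d₁ 1 x≤d₁ below (ℤP.suc[i]≤j⇒i<j (ℤP.≤-reflexive (ℤP.+-comm 1ℤ d₁))) ⟩
      cauchyTerm x y (d₁ ℤ.+ d₂) (d₁ ℤ.+ + 0) + 0#
        ≈⟨ +-identityʳ _ ⟩
      coef x (d₁ ℤ.+ + 0) * coef y (d₁ ℤ.+ d₂ ℤ.- (d₁ ℤ.+ + 0))
        ≡⟨ P.cong₂ (λ i j → coef x i * coef y j) (ℤP.+-identityʳ d₁) (eq d₁ d₂) ⟩
      coef x d₁ * coef y d₂
        ∎
      where
      eq : ∀ d₁ d₂ → d₁ ℤ.+ d₂ ℤ.- (d₁ ℤ.+ + 0) ≡ d₂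
      eq = solve-∀
      below : VanishesBelow (cauchyTerm x y (d₁ ℤ.+ d₂)) d₁
      below j j<d₁ = cauchyTerm-vanishesBelow {x} {y} {d₁ ℤ.+ d₂} y≤d₂ j (P.subst (j ℤ.<_) (eq' d₁ d₂) j<d₁)
        where
        eq' : ∀ d₁ d₂ → d₁ ≡ d₁ ℤ.+ d₂ ℤ.- d₂
        eq' = solve-∀

    IsDeg-*L : ∀ {d₁ d₂} → IsDeg x d₁ → IsDeg y d₂ → IsDeg (x *L y) (d₁ ℤ.+ d₂)
    IsDeg-*L (x≉0 , x≤d₁) (y≉0 , y≤d₂) =
      (λ xy≈0 → *-nonzero x≉0 y≉0 (trans (sym (coef-*L-top x≤d₁ y≤d₂)) xy≈0)) , AbsLe-*L x≤d₁ y≤d₂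

    IsDeg-+L-dominant : ∀ {d e} → IsDeg x d → AbsLe y e → e ℤ.< d → IsDeg (x +L y) d
    IsDeg-+L-dominant {d} (x≉0 , x≤d) y≤e e<d =
      (λ x+y≈0 → x≉0 (trans (sym (trans (+-congˡ (y≤e d e<d)) (+-identityʳ _))) x+y≈0)) ,
      AbsLe-+L x≤d (AbsLe-mono {y} y≤e (ℤP.<⇒≤ e<d))

  AbsLe-neg : ∀ x {e} → AbsLe x e → AbsLe (-L x) e
  AbsLe-neg x x≤e j e<j = trans (-‿cong (x≤e j e<j)) -0#≈0#
    where open import Algebra.Properties.Ring ring using (-0#≈0#)

  AbsLe-0L : ∀ e → AbsLe 0L e
  AbsLe-0L e j _ = refl

  AbsLe-sgn : ∀ k → AbsLe (sgn k) (+ 0)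
  AbsLe-sgn zero    = vanish 1L
  AbsLe-sgn (suc k) = AbsLe-neg (sgn k) (AbsLe-sgn k)

  IsDeg-1L : IsDeg 1L (+ 0)
  IsDeg-1L = (λ 1≈0 → 0≉1 (sym 1≈0)) , vanish 1L

  AbsLe-pred : ∀ {x h} → AbsLe x h → coef x h ≈ 0# → AbsLe x (h ℤ.- 1ℤ)
  AbsLe-pred {x} {h} x≤h top≈0 j h-1<j with h ℤ.≟ j
  ... | yes P.refl = top≈0
  ... | no  h≢j    = x≤h j (ℤP.≤∧≢⇒< (P.subst (ℤ._≤ j) (eq h) (ℤP.i<j⇒suc[i]≤j h-1<j)) h≢j)
    where
    eq : ∀ h → 1ℤ ℤ.+ (h ℤ.- 1ℤ) ≡ h
    eq = solve-∀

  AbsLe-or-IsDeg : ∀ x e → AbsLe x e ⊎ ∃[ d ] e ℤ.< d × IsDeg x d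
  AbsLe-or-IsDeg x e = scan ℤ.∣ bnd x ℤ.- e ∣ (AbsLe-mono {x} (vanish x) (X≤b+∣X-b∣ (bnd x) e))
    where
    eq : ∀ e k → e ℤ.+ (1ℤ ℤ.+ k) ℤ.- 1ℤ ≡ e ℤ.+ k
    eq = solve-∀
    scan : ∀ k → AbsLe x (e ℤ.+ + k) → AbsLe x e ⊎ ∃[ d ] e ℤ.< d × IsDeg x d
    scan zero    x≤e+0 = inj₁ (P.subst (AbsLe x) (ℤP.+-identityʳ e) x≤e+0)
    scan (suc k) x≤top with coef x (e ℤ.+ + suc k) ≟ 0#
    ... | no  top≉0 = inj₂ (e ℤ.+ + suc k , i<i+[1+n] e k , top≉0 , x≤top)
    ... | yes top≈0 = scan k (P.subst (AbsLe x) (eq e (+ k)) (AbsLe-pred {x} x≤top top≈0))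

  IsDeg-cancelˡ : ∀ a b {D d} → IsDeg (a *L b) D → IsDeg a d → IsDeg b (D ℤ.- d)
  IsDeg-cancelˡ a b {D} {d} (ab≉0 , ab≤D) a≈d with AbsLe-or-IsDeg b (D ℤ.- d)
  ... | inj₂ (d' , D-d<d' , b≈d') =
    contradiction (ab≤D _ (P.subst (ℤ._< d ℤ.+ d') (eq₁ D d) (ℤP.+-monoʳ-< d D-d<d'))) (proj₁ (IsDeg-*L a b a≈d b≈d'))
    where
    eq₁ : ∀ D d → d ℤ.+ (D ℤ.- d) ≡ D
    eq₁ = solve-∀
  ... | inj₁ b≤D-d with coef b (D ℤ.- d) ≟ 0#
  ...   | no  b≉0 = b≉0 , b≤D-d
  ...   | yes b≈0 = contradiction (AbsLe-*L a b (proj₂ a≈d) (AbsLe-pred {b} b≤D-d b≈0) D D-1<D) ab≉0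
    where
    eq₂ : ∀ D d → D ℤ.- 1ℤ ≡ d ℤ.+ (D ℤ.- d ℤ.- 1ℤ)
    eq₂ = solve-∀
    eq₃ : ∀ D → D ℤ.- 1ℤ ℤ.+ 1ℤ ≡ D
    eq₃ = solve-∀
    D-1<D : d ℤ.+ (D ℤ.- d ℤ.- 1ℤ) ℤ.< D
    D-1<D = P.subst₂ ℤ._<_ (eq₂ D d) (eq₃ D) (i<i+[1+n] (D ℤ.- 1ℤ) 0)

  open IntegerEmbedding LS-commutativeRing using (module RingSolver)
  open RingSolver using (solve; _:=_; _:+_; _:*_; _:-_; :-_; con)
  module LSR = CommutativeRing LS-commutativeRing

  -- Convergents

  module Convergents (ξ : LS) (A : ℕ → LS) (cf : IsCFExpansion ξ A) where

    posDeg : ∀ i → PosDeg (A (suc i))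
    posDeg = proj₁ (proj₂ cf)

    degQ : ℕ → ℤ
    degQ zero    = + 0
    degQ (suc m) = proj₁ (posDeg m) ℤ.+ degQ m

    degQ-< : ∀ m → degQ m ℤ.< degQ (suc m)
    degQ-< m = P.subst (ℤ._< degQ (suc m)) (ℤP.+-identityˡ (degQ m)) (ℤP.+-monoˡ-< (degQ m) (proj₁ (proj₂ (posDeg m))))

    1≈Q₀ : 1L ≈L Qn A 0
    1≈Q₀ = solve 1 (λ a → con (+ 1) := a :* con (+ 0) :+ con (+ 1)) (λ _ → refl) (A 0)

    Q-degree : ∀ m → IsDeg (Qn A m) (degQ m) × AbsLe (Qm A (suc m)) (ℤ.pred (degQ m))
    Q-degree zero    = IsDeg-resp-≈L 1L (Qn A 0) 1≈Q₀ IsDeg-1L , AbsLe-0L _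
    Q-degree (suc m) with Q-degree m
    ... | Q-deg , Qprev-small =
      IsDeg-+L-dominant (A (suc m) *L Qn A m) (Qm A (suc m)) (IsDeg-*L (A (suc m)) (Qn A m) (proj₂ (proj₂ (posDeg m))) Q-deg)
        Qprev-small (ℤP.<-trans (pred[i]<i (degQ m)) (degQ-< m)) ,
      AbsLe-mono {Qn A m} (proj₂ Q-deg) (ℤP.i<j⇒i≤pred[j] (degQ-< m))

    -- Q (M-2) P (M-1) - Q (M-1) P (M-2), in the shifted indexing of Qm and Pm
    continuantDet : ℕ → LS
    continuantDet M = Qm A M *L Pm A (suc M) -L Qm A (suc M) *L Pm A M

    continuantDet≈sgn : ∀ M → continuantDet M ≈L sgn M
    continuantDet≈sgn zero    = solve 0 (con (+ 1) :* con (+ 1) :- con (+ 0) :* con (+ 0) := con (+ 1)) (λ _ → refl)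
    continuantDet≈sgn (suc M) = LSR.trans {continuantDet (suc M)} { -L continuantDet M } {sgn (suc M)}
      (solve 5 (λ a Q₁ Q₀ P₁ P₀ → Q₁ :* (a :* P₁ :+ P₀) :- (a :* Q₁ :+ Q₀) :* P₁ := :- (Q₀ :* P₁ :- Q₁ :* P₀))
               (λ _ → refl) (A M) (Qm A (suc M)) (Qm A M) (Pm A (suc M)) (Pm A M))
      (LSR.-‿cong {continuantDet M} {sgn M} (continuantDet≈sgn M))

    residual : ℕ → LS
    residual m = Qn A m *L ξ -L Pn A m

    residual-recurrence : ∀ m → (Qn A m *L residual (suc m)) ≈L (Qn A (suc m) *L residual m -L continuantDet (suc (suc m)))
    residual-recurrence m =
      solve 5 (λ q q′ p p′ x → q :* (q′ :* x :- p′) := q′ :* (q :* x :- p) :- (q :* p′ :- q′ :* p))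
        (λ _ → refl) (Qn A m) (Qn A (suc m)) (Pn A m) (Pn A (suc m)) ξ

    -- |r m| = q^c |Q m|, and Q (m+1) r m has positive degree, so it dominates the determinant ±1.
    LargeResidual : ℕ → ℤ → Set
    LargeResidual m c = IsDeg (residual m) (c ℤ.+ degQ m) × + 0 ℤ.< degQ (suc m) ℤ.+ (c ℤ.+ degQ m)

    LargeResidual-suc : ∀ {m c} → LargeResidual m c → LargeResidual (suc m) c
    LargeResidual-suc {m} {c} (r-deg , pos) = P.subst (IsDeg (residual (suc m))) (eq₁ c (degQ m) (degQ (suc m))) r′-deg , pos′
      where
      det-small : AbsLe (-L continuantDet (suc (suc m))) (+ 0)
      det-small = AbsLe-neg (continuantDet (suc (suc m))) (AbsLe-resp-≈L (sgn (suc (suc m))) (continuantDet (suc (suc m)))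
        (LSR.sym {continuantDet (suc (suc m))} {sgn (suc (suc m))} (continuantDet≈sgn (suc (suc m)))) (AbsLe-sgn (suc (suc m))))
      Q′r-deg : IsDeg (Qn A (suc m) *L residual m -L continuantDet (suc (suc m))) (degQ (suc m) ℤ.+ (c ℤ.+ degQ m))
      Q′r-deg = IsDeg-+L-dominant (Qn A (suc m) *L residual m) (-L continuantDet (suc (suc m)))
        (IsDeg-*L (Qn A (suc m)) (residual m) (proj₁ (Q-degree (suc m))) r-deg) det-small pos
      r′-deg : IsDeg (residual (suc m)) (degQ (suc m) ℤ.+ (c ℤ.+ degQ m) ℤ.- degQ m)
      r′-deg = IsDeg-cancelˡ (Qn A m) (residual (suc m))
        (IsDeg-resp-≈L (Qn A (suc m) *L residual m -L continuantDet (suc (suc m))) (Qn A m *L residual (suc m))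
          (LSR.sym {Qn A m *L residual (suc m)} {Qn A (suc m) *L residual m -L continuantDet (suc (suc m))}
                   (residual-recurrence m))
          Q′r-deg)
        (proj₁ (Q-degree m))
      eq₁ : ∀ c d d′ → d′ ℤ.+ (c ℤ.+ d) ℤ.- d ≡ c ℤ.+ d′
      eq₁ = solve-∀
      eq₂ : ∀ c d d′ → d ℤ.+ (c ℤ.+ d′) ≡ d′ ℤ.+ (c ℤ.+ d)
      eq₂ = solve-∀
      pos′ : + 0 ℤ.< degQ (suc (suc m)) ℤ.+ (c ℤ.+ degQ (suc m))
      pos′ = ℤP.<-trans pos (P.subst (ℤ._< degQ (suc (suc m)) ℤ.+ (c ℤ.+ degQ (suc m))) (eq₂ c (degQ m) (degQ (suc m)))
               (ℤP.+-monoˡ-< (c ℤ.+ degQ (suc m)) (ℤP.<-trans (degQ-< m) (degQ-< (suc m)))))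

    no-LargeResidual : ∀ {n c} → ¬ LargeResidual n c
    no-LargeResidual {n} {c} large with proj₂ (proj₂ cf) (suc ℤ.∣ c ∣)
    ... | N , converges = proj₁ (proj₁ (iterate N)) (r-small (c ℤ.+ degQ m) (ℤP.+-monoˡ-< (degQ m) (-[1+∣i∣]<i c)))
      where
      m : ℕ
      m = N ℕ.+ n
      iterate : ∀ j → LargeResidual (j ℕ.+ n) c
      iterate zero    = large
      iterate (suc j) = LargeResidual-suc {j ℕ.+ n} {c} (iterate j)
      r-small : AbsLe (residual m) (ℤ.- + suc ℤ.∣ c ∣ ℤ.+ degQ m)
      r-small = converges m (ℕP.m≤m+n N n) (degQ m) (proj₁ (Q-degree m))

    residual-bound : ∀ n → AbsLe (residual n) (ℤ.- degQ (suc n))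
    residual-bound n with AbsLe-or-IsDeg (residual n) (ℤ.- degQ (suc n))
    ... | inj₁ small = small
    ... | inj₂ (ρ , -dQ<ρ , r-deg) =
      contradiction (P.subst (IsDeg (residual n)) (eq₁ ρ (degQ n)) r-deg , pos) (no-LargeResidual {n} {ρ ℤ.- degQ n})
      where
      eq₁ : ∀ ρ d → ρ ≡ ρ ℤ.- d ℤ.+ d
      eq₁ = solve-∀
      eq₂ : ∀ d′ → d′ ℤ.+ ℤ.- d′ ≡ + 0
      eq₂ = solve-∀
      pos : + 0 ℤ.< degQ (suc n) ℤ.+ (ρ ℤ.- degQ n ℤ.+ degQ n)
      pos = P.subst₂ ℤ._<_ (eq₂ (degQ (suc n))) (P.cong (λ i → degQ (suc n) ℤ.+ i) (eq₁ ρ (degQ n)))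
                           (ℤP.+-monoʳ-< (degQ (suc n)) -dQ<ρ)

    previousResidual : ℕ → LS
    previousResidual k = Qm A (suc k) *L ξ -L Pm A (suc k)

    previousResidual-bound : ∀ k → AbsLe (previousResidual k) (ℤ.- degQ k)
    previousResidual-bound zero    =
      AbsLe-+L (0L *L ξ) (-L 1L) (AbsLe-resp-≈L 0L (0L *L ξ) (LSR.sym {0L *L ξ} {0L} (LSR.zeroˡ ξ)) (AbsLe-0L _))
               (AbsLe-neg 1L (vanish 1L))
    previousResidual-bound (suc k) = residual-bound k

    residual-identity : ∀ k a N y →
      let γ  = N ⊗ (U a ⊗ M A k)
          δ  = m21 N *L y -L m11 N
          δ′ = m22 N *L y -L m12 N
      in (m11 γ *L ξ +L m12 γ -L y *L (m21 γ *L ξ +L m22 γ)) ≈L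
         ((-L δ) *L residual k +L (-L (δ *L a +L δ′)) *L ((-L sgn k) *L previousResidual k))
    residual-identity k a N y =
      solve 12 (λ t t′ s s′ a q p q′ p′ σ x y →
        let W₁₁ = con (+ 1) :* q :+ a :* (:- σ :* q′)
            W₁₂ = con (+ 1) :* (:- p) :+ a :* (σ :* p′)
            W₂₁ = con (+ 0) :* q :+ con (+ 1) :* (:- σ :* q′)
            W₂₂ = con (+ 0) :* (:- p) :+ con (+ 1) :* (σ :* p′)
            d   = s :* y :- t
            d′  = s′ :* y :- t′
            V₁  = t :* W₁₁ :+ t′ :* W₂₁
            U₁  = t :* W₁₂ :+ t′ :* W₂₂
            V₂  = s :* W₁₁ :+ s′ :* W₂₁
            U₂  = s :* W₁₂ :+ s′ :* W₂₂
        in V₁ :* x :+ U₁ :- y :* (V₂ :* x :+ U₂) := :- d :* (q :* x :- p) :+ :- (d :* a :+ d′) :* (:- σ :* (q′ :* x :- p′)))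
        (λ _ → refl) (m11 N) (m12 N) (m21 N) (m22 N) a (Qn A k) (Pn A k) (Qm A (suc k)) (Pm A (suc k)) (sgn k) ξ y

lemma4p4 : (F : FiniteField) → let open Laurent F in
    (ξ : LS) → Irrational ξ → AbsLe ξ (+ 0) →
    (A : ℕ → LS) → IsCFExpansion ξ A →
    (k : ℕ) → (a : LS) → IsPoly a →
    (N : Mat2) → InSL2 N →
    (y : LS) →
    let γ = N ⊗ (U a ⊗ M A k)
        V₁ = m11 γ
        U₁ = m12 γ
        V₂ = m21 γ
        U₂ = m22 γ
        δ = m21 N *L y -L m11 N
        δ′ = m22 N *L y -L m12 N
    in AbsLeMaxQuot (V₁ *L ξ +L U₁ -L y *L (V₂ *L ξ +L U₂))
                    δ (Qn A (suc k)) (δ *L a +L δ′) (Qn A k)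
lemma4p4 F ξ _ _ A cf k a _ N _ y e δ-small δ′-small =
  AbsLe-resp-≈L (term₁ +L term₂) X (LSR.sym {X} {term₁ +L term₂} (residual-identity k a N y))
    (AbsLe-+L term₁ term₂ (P.subst (AbsLe term₁) (e+d-d≡e e (degQ (suc k))) term₁-small)
                          (P.subst (AbsLe term₂) (e+d+[0-d]≡e e (degQ k)) term₂-small))
  where
  open Laurent F
  open Series F
  open Convergents ξ A cf
  δ δ′ X term₁ term₂ : LS
  δ = m21 N *L y -L m11 N
  δ′ = m22 N *L y -L m12 N
  X = m11 γ *L ξ +L m12 γ -L y *L (m21 γ *L ξ +L m22 γ)
    where
    γ : Mat2
    γ = N ⊗ (U a ⊗ M A k)
  term₁ = (-L δ) *L residual k
  term₂ = (-L (δ *L a +L δ′)) *L ((-L sgn k) *L previousResidual k)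
  term₁-small : AbsLe term₁ (e ℤ.+ degQ (suc k) ℤ.+ ℤ.- degQ (suc k))
  term₁-small = AbsLe-*L (-L δ) (residual k) (AbsLe-neg δ (δ-small (degQ (suc k)) (proj₁ (Q-degree (suc k)))))
                         (residual-bound k)
  term₂-small : AbsLe term₂ (e ℤ.+ degQ k ℤ.+ (+ 0 ℤ.+ ℤ.- degQ k))
  term₂-small = AbsLe-*L (-L (δ *L a +L δ′)) ((-L sgn k) *L previousResidual k)
                         (AbsLe-neg (δ *L a +L δ′) (δ′-small (degQ k) (proj₁ (Q-degree k))))
                         (AbsLe-*L (-L sgn k) (previousResidual k) (AbsLe-neg (sgn k) (AbsLe-sgn k)) (previousResidual-bound k))
  e+d-d≡e : ∀ e d → e ℤ.+ d ℤ.+ ℤ.- d ≡ e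
  e+d-d≡e = solve-∀
  e+d+[0-d]≡e : ∀ e d → e ℤ.+ d ℤ.+ (+ 0 ℤ.+ ℤ.- d) ≡ e
  e+d+[0-d]≡e = solve-∀
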